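{- Let $I,J\in\mathcal I$. Then there is a reconfiguration sequence between $I$ and $J$ if and only if $I$ and $J$ are $\vartriangleleft$-equivalent, i.e. the $\vartriangleleft$-minimal set in $\mathcal M(I)$ equals the $\vartriangleleft$-minimal set in $\mathcal M(J)$.
   Context: Let $a_1,\dots,a_n$ be distinct integers between $1$ and $n$, and set $a_0=0$, so $A=(a_i)_{i=0,1,\dots,n}$. A set $I\subseteq\{0\}\cup[n]$ is feasible if $a_i<a_j$ for all $i,j\in I$ with $i<j$; $\mathcal I$ denotes the family of maximum-cardinality feasible sets. A reconfiguration sequence between $I$ and $J$ is a sequence of feasible sets $I_0=I,\dots,I_\ell=J$ where each $I_t=(I_{t-1}\cup\{j\})\setminus\{k\}$ for some $j\notin I_{t-1}$, $k\in I_{t-1}$. Patience sorting: start with empty piles $P_0,P_1,\dots,P_n$; for $i=0,1,\dots,n$ in this order, put $a_i$ on the top of the leftmost (smallest-index) pile $P_j$ that is empty or whose current top element is greater than $a_i$. Let $P_0,\dots,P_k$ be the resulting nonempty piles; "$a_u$ is placed below $a_v$" means $a_u$ was put on that pile before $a_v$. For $I,J\in\mathcal I$, write $I\vartriangleleft J$ if $I\setminus J=\{u\}$, $J\setminus I=\{v\}$, and $a_u$ is placed strictly below $a_v$ on the same pile $P_i$ for some $1\le i\le k$. For $I\in\mathcal I$, $\mathcal M(I)\subseteq\mathcal I$ is the smallest family containing $I$ such that $J\in\mathcal M(I)$ and $J'\vartriangleleft J$ imply $J'\in\mathcal M(I)$. A set is $\vartriangleleft$-minimal if there is no $J'\in\mathcal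 I$ with $J'\vartriangleleft J$; each $\mathcal M(I)$ contains exactly one $\vartriangleleft$-minimal set. -}

module Defs where

open import Data.Nat using (ℕ; zero; suc; _≤_; _<_; _<ᵇ_)
open import Data.Bool using (if_then_else_)
open import Data.Fin using (Fin; toℕ) renaming (zero to fzero; suc to fsuc)
open import Data.Fin.Subset using (Subset; _∈_; _∉_; _∪_; _─_; ⁅_⁆; ∣_∣)
open import Data.List using (List; []; _∷_; [_]; foldl; allFin; length; lookup)
open import Data.List.Membership.Propositional using () renaming (_∈_ to _∈ₗ_)
open import Data.Product using (Σ; ∃; ∃-syntax; _×_)
open import Data.Sum using (_⊎_)
open import Data.Empty using (⊥)
open import Relation.Nullary using (¬_)
open import Relation.Binary.PropositionalEquality using (_≡_)
open import Relation.Binary.Construct.Closure.ReflexiveTransitive using (Star)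

-- The input: a : Fin n → ℕ (a_1..a_n), extended by a_0 = 0.
-- Index 0 of Fin (suc n) corresponds to a_0, index (fsuc i) to a_{i+1}.
ext : {n : ℕ} → (Fin n → ℕ) → Fin (suc n) → ℕ
ext a fzero    = 0
ext a (fsuc i) = a i

module _ {n : ℕ} (A : Fin (suc n) → ℕ) where

  Feasible : Subset (suc n) → Set
  Feasible I = ∀ i j → i ∈ I → j ∈ I → toℕ i < toℕ j → A i < A j

  -- I ∈ 𝓘 : feasible of maximum cardinality
  Max : Subset (suc n) → Set
  Max I = Feasible I × (∀ J → Feasible J → ∣ J ∣ ≤ ∣ I ∣)

  RStep : Subset (suc n) → Subset (suc n) → Set
  RStep I I' = Feasible I × Feasible I' ×
    ∃[ j ] ∃[ k ] (j ∉ I × k ∈ I × I' ≡ (I ∪ ⁅ j ⁆) ─ ⁅ k ⁆)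

  Reconf : Subset (suc n) → Subset (suc n) → Set
  Reconf I J = Feasible I × Star RStep I J

  -- A pile is a list of indices, top element first.
  -- The nonempty piles always form a prefix P₀,…,P_k of P₀,…,P_n, so the
  -- state is the list of nonempty piles; a new pile is appended at the end.
  insert : Fin (suc n) → List (List (Fin (suc n))) → List (List (Fin (suc n)))
  insert x []              = [ x ] ∷ []
  insert x ([] ∷ ps)       = [ x ] ∷ ps
  insert x ((y ∷ p) ∷ ps)  =
    if A x <ᵇ A y then (x ∷ y ∷ p) ∷ ps else (y ∷ p) ∷ insert x ps

  -- piles after processing i = 0, 1, …, n in order; position i of the list is P_i
  piles : List (List (Fin (suc n)))
  piles = foldl (λ ps i → insert i ps) [] (allFin (suc n))

  BelowIn : Fin (suc n) → Fin (suc n) → List (Fin (suc n)) → Set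
  BelowIn u v []      = ⊥
  BelowIn u v (x ∷ p) = (x ≡ v × u ∈ₗ p) ⊎ BelowIn u v p

  PlacedBelow : Fin (suc n) → Fin (suc n) → Set
  PlacedBelow u v = ∃[ i ] (1 ≤ toℕ i × BelowIn u v (lookup piles i))

  _◁_ : Subset (suc n) → Subset (suc n) → Set
  I ◁ J = Max I × Max J ×
    ∃[ u ] ∃[ v ] (I ─ J ≡ ⁅ u ⁆ × J ─ I ≡ ⁅ v ⁆ × PlacedBelow u v)

  -- 𝓜(I): least family containing I and closed downward under ◁
  data InM (I : Subset (suc n)) : Subset (suc n) → Set where
    base : InM I I
    down : ∀ {J J'} → InM I J → J' ◁ J → InM I J'

  Minimal : Subset (suc n) → Set
  Minimal J = Max J × ¬ (∃[ J' ] (J' ◁ J))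

  ◁-Equiv : Subset (suc n) → Subset (suc n) → Set
  ◁-Equiv I J = ∃[ K ] (Minimal K × InM I K × InM J K)

module Submission where

-- Patience sorting puts a_x on pile p exactly when the longest increasing subsequence ending
-- at a_x has p + 1 elements: following predecessors on the piles to the left gives one of that
-- length, and the pile index strictly increases along any increasing subsequence. Hence the
-- element of rank r of a maximum feasible set lies on pile r, and a reconfiguration step between
-- maximum sets swaps two elements of one pile; as a_0 = 0 is alone on P_0, that is a ◁-step in
-- one direction or the other, and conversely every ◁-step is a reconfiguration step.
-- Replacing an element by one placed below it lowers the index sum, so the reduction
-- X ⟶ Y ⇔ Y ◁ X terminates, and two reductions of one set are rejoined by performing both
-- exchanges (or, when both remove the same element, by exchanging the two added ones). By
-- Newman's lemma the reduction is confluent, so every reconfiguration class has exactly one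
-- ◁-minimal set: the common normal form of its members.

open import Defs
open import Data.Bool using (Bool; true; false; T; if_then_else_)
open import Data.Unit using (tt)
open import Data.Nat using (ℕ; zero; suc; _+_; _≤_; _<_; z≤n; s≤s; _<ᵇ_; _<?_; _≤?_)
open import Data.Nat.Properties
  using (+-cancelʳ-<; +-comm; +-commutativeSemigroup; +-identityʳ; +-mono-<-≤; +-monoʳ-<; +-monoʳ-≤; +-suc;
         <-asym; <-cmp; <-irrefl; <-trans; <-≤-trans; <ᵇ⇒<; <⇒<ᵇ; <⇒≢; <⇒≤; <⇒≱; m<1+n⇒m<n∨m≡n; m<n⇒m<1+n;
         m≤n⇒m<n∨m≡n; m≤n⇒m≤1+n; n≮0; suc-injective; ≤-<-trans; ≤-antisym; ≤-pred; ≤-refl; ≤-reflexive;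
         ≤-trans; ≤∧≢⇒<; ≮⇒≥; ≰⇒>; module ≤-Reasoning)
open import Algebra.Properties.CommutativeSemigroup +-commutativeSemigroup using (x∙yz≈y∙xz)
open import Data.Fin using (Fin; toℕ; _≟_) renaming (zero to fzero; suc to fsuc)
open import Data.Fin.Properties using (toℕ-injective; toℕ<n) renaming (any? to anyFin?; all? to allFin?)
open import Data.Fin.Subset using (Subset; _∈_; _∉_; _⊆_; _∪_; _─_; _-_; ⁅_⁆; ∣_∣)
open import Data.Fin.Subset.Properties
  using (_∈?_; ⊆-antisym; x∈⁅x⁆; x∈⁅y⁆⇒x≡y; x∈p∪q⁺; x∈p∪q⁻; p⊆p∪q; p─q⊆p; x∈p∧x∉q⇒x∈p─q; ∪-identityʳ; p─⊥≡p)
open import Data.Vec using (_∷_; []; here; there)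
open import Data.List using (List; []; _∷_; foldl; tabulate; lookup)
open import Data.List.Membership.Propositional using () renaming (_∈_ to _∈ₗ_)
open import Data.List.Relation.Unary.Any using (here; there)
open import Data.List.Relation.Unary.All as All using ([]; _∷_)
open import Data.List.Relation.Unary.AllPairs using (AllPairs; []; _∷_)
open import Data.Product using (∃-syntax; _×_; _,_; proj₁; proj₂)
open import Data.Sum using (_⊎_; inj₁; inj₂)
open import Data.Empty using (⊥-elim)
open import Function using (_∘_; id)
open import Function.Definitions using (Injective)
open import Relation.Nullary using (Dec; yes; no; ¬?)
open import Relation.Binary using (tri<; tri≈; tri>)
open import Relation.Nullary.Decidable using (_×-dec_; _⊎-dec_; _→-dec_)
open import Relation.Binary.PropositionalEquality hiding (J)
open import Relation.Binary.Construct.Closure.ReflexiveTransitive as Star using (Star; ε; _◅_; _◅◅_)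
open import Relation.Binary.Construct.Closure.Symmetric using (SymClosure; fwd; bwd)
open import Relation.Binary.Construct.Closure.Equivalence using (EqClosure; symmetric)
open import Relation.Binary.Construct.Closure.Equivalence.Properties using (a—↠b⇒a↔b)
open import Relation.Binary.Construct.Closure.Transitive using (Plus; [_]; _∼⁺⟨_⟩_)
open import Relation.Binary.Construct.On as On using ()
open import Relation.Binary.Rewriting using (HasNormalForm; WeaklyConfluent; Confluent; sn&wcr⇒cr; conf⇒nf)
open import Induction.WellFounded using (Acc; acc; module Subrelation)
open import Data.Nat.Induction using (<-wellFounded)

-- Characteristic functions and prefix counts

χ : ∀ {m} → Subset m → ℕ → Bool
χ []      _       = false
χ (b ∷ S) zero    = b
χ (b ∷ S) (suc t) = χ S t

∈⇒χ : ∀ {m} {S : Subset m} {y} → y ∈ S → χ S (toℕ y) ≡ true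
∈⇒χ here      = refl
∈⇒χ (there p) = ∈⇒χ p

χ⇒∈ : ∀ {m} {S : Subset m} {y} → χ S (toℕ y) ≡ true → y ∈ S
χ⇒∈ {S = true ∷ S} {fzero}  _ = here
χ⇒∈ {S = b ∷ S}    {fsuc y} e = there (χ⇒∈ e)

χ⇒∃∈ : ∀ {m} {S : Subset m} {t} → χ S t ≡ true → ∃[ y ] (y ∈ S × toℕ y ≡ t)
χ⇒∃∈ {S = true ∷ S} {zero}  _ = fzero , here , refl
χ⇒∃∈ {S = b ∷ S}    {suc t} e with χ⇒∃∈ {S = S} e
... | y , y∈S , y≡t = fsuc y , there y∈S , cong suc y≡t

splice : ∀ {m} → Subset m → Subset m → ℕ → Subset m
splice C       I       zero    = I
splice []      []      (suc s) = []
splice (c ∷ C) (_ ∷ I) (suc s) = c ∷ splice C I s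

χ-splice-< : ∀ {m} (C I : Subset m) {s t} → t < s → χ (splice C I s) t ≡ χ C t
χ-splice-< []      []      {suc s} _               = refl
χ-splice-< (c ∷ C) (_ ∷ I) {suc s} {zero}  _       = refl
χ-splice-< (c ∷ C) (_ ∷ I) {suc s} {suc t} (s≤s t<s) = χ-splice-< C I t<s

χ-splice-≥ : ∀ {m} (C I : Subset m) {s t} → s ≤ t → χ (splice C I s) t ≡ χ I t
χ-splice-≥ C       I       {zero}          _         = refl
χ-splice-≥ []      []      {suc s}         _         = refl
χ-splice-≥ (c ∷ C) (_ ∷ I) {suc s} {suc t} (s≤s s≤t) = χ-splice-≥ C I s≤t

∈-splice⁻ : ∀ {m} {C I : Subset m} s {y} → y ∈ splice C I s → (toℕ y < s × y ∈ C) ⊎ (s ≤ toℕ y × y ∈ I)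
∈-splice⁻ {C = C} {I} s {y} y∈ with toℕ y <? s
... | yes y<s = inj₁ (y<s , χ⇒∈ (trans (sym (χ-splice-< C I y<s)) (∈⇒χ y∈)))
... | no  y≮s = inj₂ (≮⇒≥ y≮s , χ⇒∈ (trans (sym (χ-splice-≥ C I (≮⇒≥ y≮s))) (∈⇒χ y∈)))

count : (ℕ → Bool) → ℕ → ℕ
count g zero    = 0
count g (suc t) = if g t then suc (count g t) else count g t

count-true : ∀ g {t} → g t ≡ true → count g (suc t) ≡ suc (count g t)
count-true g e rewrite e = refl

count-cong : ∀ {g h} T → (∀ t → t < T → g t ≡ h t) → count g T ≡ count h T
count-cong zero    _  = refl
count-cong {g} {h} (suc T) eq rewrite eq T ≤-refl with h T
... | true  = cong suc (count-cong T (λ t t<T → eq t (m<n⇒m<1+n t<T)))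
... | false = count-cong T (λ t t<T → eq t (m<n⇒m<1+n t<T))

count-monoˡ : ∀ {g h} T → (∀ t → g t ≡ true → h t ≡ true) → count g T ≤ count h T
count-monoˡ zero _ = z≤n
count-monoˡ {g} {h} (suc T) g⇒h with g T in e
... | true  rewrite g⇒h T e = s≤s (count-monoˡ T g⇒h)
... | false with h T
...   | true  = m≤n⇒m≤1+n (count-monoˡ T g⇒h)
...   | false = count-monoˡ T g⇒h

count-⊆ : ∀ {m} {S T : Subset m} t → S ⊆ T → count (χ S) t ≤ count (χ T) t
count-⊆ {S = S} {T} t S⊆T = count-monoˡ t λ _ e →
  let y , y∈S , y≡t = χ⇒∃∈ {S = S} e in subst (λ t → χ T t ≡ true) y≡t (∈⇒χ (S⊆T y∈S))

count-monoʳ : ∀ g {s t} → s ≤ t → count g s ≤ count g t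
count-monoʳ g {t = zero}  z≤n = z≤n
count-monoʳ g {s} {suc t} s≤1+t with m≤n⇒m<n∨m≡n s≤1+t
... | inj₂ refl = ≤-refl
... | inj₁ (s≤s s≤t) with g t
...   | true  = m≤n⇒m≤1+n (count-monoʳ g s≤t)
...   | false = count-monoʳ g s≤t

count-strict : ∀ g {t T} → g t ≡ true → t < T → count g t < count g T
count-strict g {t} e t<T = ≤-trans (≤-reflexive (sym (count-true g e))) (count-monoʳ g t<T)

count-agree-from : ∀ {g h} s T → s ≤ T → (∀ t → s ≤ t → g t ≡ h t) →
                   count g T + count h s ≡ count h T + count g s
count-agree-from s zero z≤n _ = refl
count-agree-from {g} {h} s (suc T) s≤1+T eq with m≤n⇒m<n∨m≡n s≤1+T
... | inj₂ refl = +-comm (count g (suc T)) (count h (suc T))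
... | inj₁ (s≤s s≤T) rewrite eq T s≤T with h T
...   | true  = cong suc (count-agree-from s T s≤T eq)
...   | false = count-agree-from s T s≤T eq

count-hits : ∀ g {r} T → r < count g T → ∃[ t ] (t < T × g t ≡ true × count g t ≡ r)
count-hits g {r} (suc T) r<c with g T in e
... | false = let t , t<T , gt , ct = count-hits g T r<c in t , m<n⇒m<1+n t<T , gt , ct
... | true with m≤n⇒m<n∨m≡n (≤-pred r<c)
...   | inj₁ r<cT = let t , t<T , gt , ct = count-hits g T r<cT in t , m<n⇒m<1+n t<T , gt , ct
...   | inj₂ refl = T , ≤-refl , e , refl

count-shift : ∀ g T → count g (suc T) ≡ (if g 0 then suc else id) (count (g ∘ suc) T)
count-shift g zero with g 0
... | true  = refl
... | false = refl
count-shift g (suc T) rewrite count-shift g T with g 0 | g (suc T)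
... | true  | true  = refl
... | true  | false = refl
... | false | true  = refl
... | false | false = refl

∣∣≡count : ∀ {m} (S : Subset m) → ∣ S ∣ ≡ count (χ S) m
∣∣≡count []                = refl
∣∣≡count {suc m} (true ∷ S)  = trans (cong suc (∣∣≡count S)) (sym (count-shift (χ (true ∷ S)) m))
∣∣≡count {suc m} (false ∷ S) = trans (∣∣≡count S) (sym (count-shift (χ (false ∷ S)) m))

-- Exchanging one element of a subset

exchange : ∀ {m} → Subset m → Fin m → Fin m → Subset m
exchange X j k = (X ∪ ⁅ j ⁆) - k

x∈p─q⇒x∉q : ∀ {m} {p q : Subset m} {x} → x ∈ p ─ q → x ∉ q
x∈p─q⇒x∉q {p = _ ∷ _} {true ∷ _}  ()        here
x∈p─q⇒x∉q {p = _ ∷ _} {_ ∷ _}     (there x∈) (there x∈q) = x∈p─q⇒x∉q x∈ x∈q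

module _ {m : ℕ} {X : Subset m} {j k : Fin m} where

  ∈-exchange⁻ : ∀ {y} → y ∈ exchange X j k → (y ∈ X ⊎ y ≡ j) × y ≢ k
  ∈-exchange⁻ {y} y∈ =
    Data.Sum.map₂ (x∈⁅y⁆⇒x≡y j) (x∈p∪q⁻ X ⁅ j ⁆ (p─q⊆p _ _ y∈)) ,
    λ { refl → x∈p─q⇒x∉q y∈ (x∈⁅x⁆ k) }

  ∈-exchange⁺ : ∀ {y} → y ∈ X ⊎ y ≡ j → y ≢ k → y ∈ exchange X j k
  ∈-exchange⁺ y∈ y≢k =
    x∈p∧x∉q⇒x∈p─q (x∈p∪q⁺ (Data.Sum.map₂ (λ { refl → x∈⁅x⁆ j }) y∈)) (y≢k ∘ x∈⁅y⁆⇒x≡y k)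

  ∉exchange : ∀ {y} → y ∉ X → y ≢ j → y ∉ exchange X j k
  ∉exchange y∉X y≢j y∈ with proj₁ (∈-exchange⁻ y∈)
  ... | inj₁ y∈X = y∉X y∈X
  ... | inj₂ y≡j = y≢j y≡j

  j∈exchange : j ∉ X → k ∈ X → j ∈ exchange X j k
  j∈exchange j∉X k∈X = ∈-exchange⁺ (inj₂ refl) λ { refl → j∉X k∈X }

  exchange-─ : j ∉ X → k ∈ X → X ─ exchange X j k ≡ ⁅ k ⁆ × exchange X j k ─ X ≡ ⁅ j ⁆
  exchange-─ j∉X k∈X =
    ⊆-antisym removed (λ y∈ → subst (_∈ _) (sym (x∈⁅y⁆⇒x≡y k y∈)) k-removed) ,
    ⊆-antisym added (λ y∈ → subst (_∈ _) (sym (x∈⁅y⁆⇒x≡y j y∈)) j-added)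
    where
    removed : X ─ exchange X j k ⊆ ⁅ k ⁆
    removed {y} y∈ with y ≟ k
    ... | yes refl = x∈⁅x⁆ k
    ... | no y≢k   = ⊥-elim (x∈p─q⇒x∉q y∈ (∈-exchange⁺ (inj₁ (p─q⊆p _ _ y∈)) y≢k))
    added : exchange X j k ─ X ⊆ ⁅ j ⁆
    added y∈ with proj₁ (∈-exchange⁻ (p─q⊆p _ _ y∈))
    ... | inj₁ y∈X  = ⊥-elim (x∈p─q⇒x∉q y∈ y∈X)
    ... | inj₂ refl = x∈⁅x⁆ j
    k-removed : k ∈ X ─ exchange X j k
    k-removed = x∈p∧x∉q⇒x∈p─q k∈X (λ k∈ → proj₂ (∈-exchange⁻ k∈) refl)
    j-added : j ∈ exchange X j k ─ X
    j-added = x∈p∧x∉q⇒x∈p─q (j∈exchange j∉X k∈X) j∉X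

module _ {m : ℕ} {X Y : Subset m} {u v : Fin m} where

  ─≡⁅⁆⇒exchange : X ─ Y ≡ ⁅ u ⁆ → Y ─ X ≡ ⁅ v ⁆ → v ∉ X × u ∈ X × Y ≡ exchange X v u
  ─≡⁅⁆⇒exchange X─Y≡u Y─X≡v = v∉X , u∈X , ⊆-antisym Y⊆ ⊆Y
    where
    u∈X─Y : u ∈ X ─ Y
    u∈X─Y = subst (u ∈_) (sym X─Y≡u) (x∈⁅x⁆ u)
    v∈Y─X : v ∈ Y ─ X
    v∈Y─X = subst (v ∈_) (sym Y─X≡v) (x∈⁅x⁆ v)
    u∈X = p─q⊆p X Y u∈X─Y
    v∉X = x∈p─q⇒x∉q v∈Y─X
    Y⊆ : Y ⊆ exchange X v u
    Y⊆ {y} y∈Y with y ∈? X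
    ... | yes y∈X = ∈-exchange⁺ (inj₁ y∈X) λ { refl → x∈p─q⇒x∉q u∈X─Y y∈Y }
    ... | no  y∉X = ∈-exchange⁺ (inj₂ (x∈⁅y⁆⇒x≡y v y∈Y─X)) λ { refl → x∈p─q⇒x∉q u∈X─Y y∈Y }
      where y∈Y─X = subst (y ∈_) Y─X≡v (x∈p∧x∉q⇒x∈p─q y∈Y y∉X)
    ⊆Y : exchange X v u ⊆ Y
    ⊆Y {y} y∈ with ∈-exchange⁻ y∈
    ... | inj₂ refl , _  = p─q⊆p Y X v∈Y─X
    ... | inj₁ y∈X , y≢u with y ∈? Y
    ...   | yes y∈Y = y∈Y
    ...   | no  y∉Y = ⊥-elim (y≢u (x∈⁅y⁆⇒x≡y u (subst (y ∈_) X─Y≡u (x∈p∧x∉q⇒x∈p─q y∈X y∉Y))))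

module _ {m : ℕ} {X : Subset m} where

  exchange-cancel : ∀ {u₁ u₂ v : Fin m} → u₁ ∉ X → u₁ ≢ u₂ → u₂ ≢ v →
                    exchange (exchange X u₁ v) u₂ u₁ ≡ exchange X u₂ v
  exchange-cancel {u₁} {u₂} {v} u₁∉X u₁≢u₂ u₂≢v = ⊆-antisym ⊆ʳ ⊆ˡ
    where
    ⊆ʳ : exchange (exchange X u₁ v) u₂ u₁ ⊆ exchange X u₂ v
    ⊆ʳ y∈ with ∈-exchange⁻ y∈
    ... | inj₂ refl , _ = ∈-exchange⁺ (inj₂ refl) u₂≢v
    ... | inj₁ y∈′ , y≢u₁ with ∈-exchange⁻ y∈′
    ...   | inj₁ y∈X , y≢v = ∈-exchange⁺ (inj₁ y∈X) y≢v
    ...   | inj₂ refl , _  = ⊥-elim (y≢u₁ refl)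
    ⊆ˡ : exchange X u₂ v ⊆ exchange (exchange X u₁ v) u₂ u₁
    ⊆ˡ y∈ with ∈-exchange⁻ y∈
    ... | inj₁ y∈X , y≢v = ∈-exchange⁺ (inj₁ (∈-exchange⁺ (inj₁ y∈X) y≢v)) λ { refl → u₁∉X y∈X }
    ... | inj₂ refl , _  = ∈-exchange⁺ (inj₂ refl) (u₁≢u₂ ∘ sym)

  exchange-comm : ∀ {u₁ v₁ u₂ v₂ : Fin m} → u₁ ≢ v₂ → u₂ ≢ v₁ →
                  exchange (exchange X u₁ v₁) u₂ v₂ ≡ exchange (exchange X u₂ v₂) u₁ v₁
  exchange-comm u₁≢v₂ u₂≢v₁ = ⊆-antisym (swap⊆ u₁≢v₂ u₂≢v₁) (swap⊆ u₂≢v₁ u₁≢v₂)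
    where
    swap⊆ : ∀ {u₁ v₁ u₂ v₂ : Fin m} → u₁ ≢ v₂ → u₂ ≢ v₁ →
            exchange (exchange X u₁ v₁) u₂ v₂ ⊆ exchange (exchange X u₂ v₂) u₁ v₁
    swap⊆ u₁≢v₂ u₂≢v₁ y∈ with ∈-exchange⁻ y∈
    ... | inj₂ refl , y≢v₂ = ∈-exchange⁺ (inj₁ (∈-exchange⁺ (inj₂ refl) y≢v₂)) u₂≢v₁
    ... | inj₁ y∈′ , y≢v₂ with ∈-exchange⁻ y∈′
    ...   | inj₁ y∈X , y≢v₁ = ∈-exchange⁺ (inj₁ (∈-exchange⁺ (inj₁ y∈X) y≢v₂)) y≢v₁
    ...   | inj₂ refl , y≢v₁ = ∈-exchange⁺ (inj₂ refl) y≢v₁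

weight : ∀ {m} → (Fin m → ℕ) → Subset m → ℕ
weight w []          = 0
weight w (true ∷ S)  = w fzero + weight (w ∘ fsuc) S
weight w (false ∷ S) = weight (w ∘ fsuc) S

∣∣≡weight : ∀ {m} (S : Subset m) → ∣ S ∣ ≡ weight (λ _ → 1) S
∣∣≡weight []          = refl
∣∣≡weight (true ∷ S)  = cong suc (∣∣≡weight S)
∣∣≡weight (false ∷ S) = ∣∣≡weight S

weight-∪⁅⁆ : ∀ {m} w {S : Subset m} {j} → j ∉ S → weight w (S ∪ ⁅ j ⁆) ≡ w j + weight w S
weight-∪⁅⁆ w {true ∷ S}  {fzero}  j∉S = ⊥-elim (j∉S here)
weight-∪⁅⁆ w {false ∷ S} {fzero}  _   = cong (λ T → w fzero + weight (w ∘ fsuc) T) (∪-identityʳ S)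
weight-∪⁅⁆ w {true ∷ S}  {fsuc j} j∉S =
  trans (cong (w fzero +_) (weight-∪⁅⁆ (w ∘ fsuc) (j∉S ∘ there)))
        (x∙yz≈y∙xz (w fzero) (w (fsuc j)) (weight (w ∘ fsuc) S))
weight-∪⁅⁆ w {false ∷ S} {fsuc j} j∉S = weight-∪⁅⁆ (w ∘ fsuc) (j∉S ∘ there)

weight-─⁅⁆ : ∀ {m} w {S : Subset m} {k} → k ∈ S → w k + weight w (S - k) ≡ weight w S
weight-─⁅⁆ w {true ∷ S}  here        = cong (λ T → w fzero + weight (w ∘ fsuc) T) (p─⊥≡p S)
weight-─⁅⁆ w {true ∷ S}  {fsuc k} (there k∈S) =
  trans (x∙yz≈y∙xz (w (fsuc k)) (w fzero) (weight (w ∘ fsuc) (S - k)))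
        (cong (w fzero +_) (weight-─⁅⁆ (w ∘ fsuc) k∈S))
weight-─⁅⁆ w {false ∷ S} (there k∈S) = weight-─⁅⁆ (w ∘ fsuc) k∈S

weight-exchange : ∀ {m} w {X : Subset m} {j k} → j ∉ X → k ∈ X →
                  w k + weight w (exchange X j k) ≡ w j + weight w X
weight-exchange w j∉X k∈X = trans (weight-─⁅⁆ w (x∈p∪q⁺ (inj₁ k∈X))) (weight-∪⁅⁆ w j∉X)

∣exchange∣ : ∀ {m} {X : Subset m} {j k} → j ∉ X → k ∈ X → ∣ exchange X j k ∣ ≡ ∣ X ∣
∣exchange∣ {X = X} {j} {k} j∉X k∈X = suc-injective (begin
  suc ∣ exchange X j k ∣                  ≡⟨ cong suc (∣∣≡weight (exchange X j k)) ⟩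
  suc (weight (λ _ → 1) (exchange X j k)) ≡⟨ weight-exchange (λ _ → 1) j∉X k∈X ⟩
  suc (weight (λ _ → 1) X)                ≡⟨ cong suc (∣∣≡weight X) ⟨
  suc ∣ X ∣                               ∎)
  where open ≡-Reasoning

-- Increasing subsequences and patience sorting

module Increasing {n : ℕ} (A : Fin (suc n) → ℕ) where

  _≺_ : Fin (suc n) → Fin (suc n) → Set
  y ≺ z = toℕ y < toℕ z × A y < A z

  Feasible-⁅⁆ : ∀ x → Feasible A ⁅ x ⁆
  Feasible-⁅⁆ x y z y∈ z∈ y<z with x∈⁅y⁆⇒x≡y x y∈ | x∈⁅y⁆⇒x≡y x z∈
  ... | refl | refl = ⊥-elim (<-irrefl refl y<z)

  Feasible-∪⁅⁆ : ∀ {C x} → Feasible A C → (∀ {y} → y ∈ C → y ≺ x) → Feasible A (C ∪ ⁅ x ⁆)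
  Feasible-∪⁅⁆ {C} {x} fC C≺x y z y∈ z∈ y<z with x∈p∪q⁻ C ⁅ x ⁆ y∈ | x∈p∪q⁻ C ⁅ x ⁆ z∈
  ... | inj₁ y∈C | inj₁ z∈C = fC y z y∈C z∈C y<z
  ... | inj₁ y∈C | inj₂ z∈x rewrite x∈⁅y⁆⇒x≡y x z∈x = proj₂ (C≺x y∈C)
  ... | inj₂ y∈x | inj₁ z∈C rewrite x∈⁅y⁆⇒x≡y x y∈x = ⊥-elim (<-asym y<z (proj₁ (C≺x z∈C)))
  ... | inj₂ y∈x | inj₂ z∈x rewrite x∈⁅y⁆⇒x≡y x y∈x | x∈⁅y⁆⇒x≡y x z∈x = ⊥-elim (<-irrefl refl y<z)

  Feasible-splice : ∀ {C I} s → Feasible A C → Feasible A I →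
                    (∀ {y z} → y ∈ C → z ∈ I → toℕ y < s → s ≤ toℕ z → A y < A z) →
                    Feasible A (splice C I s)
  Feasible-splice s fC fI cross y z y∈ z∈ y<z with ∈-splice⁻ s y∈ | ∈-splice⁻ s z∈
  ... | inj₁ (_ , y∈C)   | inj₁ (_ , z∈C)   = fC y z y∈C z∈C y<z
  ... | inj₁ (y<s , y∈C) | inj₂ (s≤z , z∈I) = cross y∈C z∈I y<s s≤z
  ... | inj₂ (s≤y , _)   | inj₁ (z<s , _)   = ⊥-elim (<-asym y<z (<-≤-trans z<s s≤y))
  ... | inj₂ (_ , y∈I)   | inj₂ (_ , z∈I)   = fI y z y∈I z∈I y<z

module PatienceSorting {n : ℕ} (A : Fin (suc n) → ℕ) (A-injective : Injective _≡_ _≡_ A) where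

  open Increasing A using (_≺_)

  Index : Set
  Index = Fin (suc n)

  Pile : Set
  Pile = List Index

  Above : Index → Index → Set
  Above y z = toℕ z < toℕ y × A y < A z

  Above-trans : ∀ {x y z} → Above x y → Above y z → Above x z
  Above-trans (y<x , Ax<Ay) (z<y , Ay<Az) = <-trans z<y y<x , <-trans Ax<Ay Ay<Az

  data OnPile (x : Index) : ℕ → List Pile → Set where
    here  : ∀ {p ps} → x ∈ₗ p → OnPile x 0 (p ∷ ps)
    there : ∀ {i p ps} → OnPile x i ps → OnPile x (suc i) (p ∷ ps)

  data WellFormed : List Pile → Set where
    []     : WellFormed []
    cons   : ∀ {y p ps} → AllPairs Above (y ∷ p) → (∀ {z i} → OnPile z i ps → A y < A z) →
             WellFormed ps → WellFormed ((y ∷ p) ∷ ps)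

  top-least : ∀ {y p z} → AllPairs Above (y ∷ p) → z ∈ₗ (y ∷ p) → z ≡ y ⊎ A y < A z
  top-least _              (here refl) = inj₁ refl
  top-least (y>p ∷ _) (there z∈p) = inj₂ (proj₂ (All.lookup y>p z∈p))

  record Inserted (x : Index) (ps r : List Pile) : Set where
    field
      pile       : ℕ
      old-or-new : ∀ {z i} → OnPile z i r → OnPile z i ps ⊎ (z ≡ x × i ≡ pile)
      keeps      : ∀ {z i} → OnPile z i ps → OnPile z i r
      placed     : OnPile x pile r
      smaller    : ∀ i → i < pile → ∃[ y ] (OnPile y i ps × A y < A x)
      larger     : ∀ {z i} → pile ≤ i → OnPile z i ps → A x < A z
      wellFormed : WellFormed r

  insert-spec : ∀ x ps → WellFormed ps → (∀ {z i} → OnPile z i ps → toℕ z < toℕ x) →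
                Inserted x ps (insert A x ps)
  insert-spec x [] _ _ = record
    { pile       = 0
    ; old-or-new = λ { (here (here refl)) → inj₂ (refl , refl) }
    ; keeps      = λ ()
    ; placed     = here (here refl)
    ; smaller    = λ _ ()
    ; larger     = λ _ ()
    ; wellFormed = cons ([] ∷ []) (λ ()) [] }
  insert-spec x ((y ∷ p) ∷ ps) (cons y∷p-sorted@(y>p ∷ _) y<ps ps-wf) earlier with A x <ᵇ A y in e
  ... | true  = onto-first
    where
    x-above-y : Above x y
    x-above-y = earlier (here (here refl)) , <ᵇ⇒< (A x) (A y) (subst T (sym e) tt)
    x<pile : ∀ {z} → z ∈ₗ (y ∷ p) → A x < A z
    x<pile z∈ with top-least y∷p-sorted z∈
    ... | inj₁ refl = proj₂ x-above-y
    ... | inj₂ Ay<Az = <-trans (proj₂ x-above-y) Ay<Az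
    onto-first : Inserted x ((y ∷ p) ∷ ps) ((x ∷ y ∷ p) ∷ ps)
    onto-first = record
      { pile       = 0
      ; old-or-new = λ { (here (here refl)) → inj₂ (refl , refl)
                       ; (here (there z∈)) → inj₁ (here z∈)
                       ; (there z∈ps) → inj₁ (there z∈ps) }
      ; keeps      = λ { (here z∈) → here (there z∈) ; (there z∈ps) → there z∈ps }
      ; placed     = here (here refl)
      ; smaller    = λ _ ()
      ; larger     = λ { _ (here z∈) → x<pile z∈ ; _ (there z∈ps) → <-trans (proj₂ x-above-y) (y<ps z∈ps) }
      ; wellFormed = cons ((x-above-y ∷ All.map (Above-trans x-above-y) y>p) ∷ y∷p-sorted)
                          (λ z∈ps → <-trans (proj₂ x-above-y) (y<ps z∈ps)) ps-wf }
  ... | false = past-first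
    where
    rest : Inserted x ps (insert A x ps)
    rest = insert-spec x ps ps-wf (λ z∈ps → earlier (there z∈ps))
    open Inserted rest
    y<x : A y < A x
    y<x = ≤∧≢⇒< (≮⇒≥ (λ x<y → subst T e (<⇒<ᵇ x<y)))
                (λ Ay≡Ax → <⇒≢ (earlier (here (here refl))) (cong toℕ (A-injective Ay≡Ax)))
    past-first : Inserted x ((y ∷ p) ∷ ps) ((y ∷ p) ∷ insert A x ps)
    past-first = record
      { pile       = suc pile
      ; old-or-new = λ { (here z∈) → inj₁ (here z∈)
                       ; (there z∈r) → Data.Sum.map there (λ (z≡x , i≡j) → z≡x , cong suc i≡j) (old-or-new z∈r) }
      ; keeps      = λ { (here z∈) → here z∈ ; (there z∈ps) → there (keeps z∈ps) }
      ; placed     = there placed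
      ; smaller    = λ { zero _ → y , here (here refl) , y<x
                       ; (suc i) (s≤s i<j) → let y′ , y′∈ , y′<x = smaller i i<j in y′ , there y′∈ , y′<x }
      ; larger     = λ { (s≤s j≤i) (there z∈ps) → larger j≤i z∈ps }
      ; wellFormed = cons y∷p-sorted y<r wellFormed }
      where
      y<r : ∀ {z i} → OnPile z i (insert A x ps) → A y < A z
      y<r z∈r with old-or-new z∈r
      ... | inj₁ z∈ps       = y<ps z∈ps
      ... | inj₂ (refl , _) = y<x

  record Invariant (t : ℕ) (ps : List Pile) : Set where
    field
      wellFormed  : WellFormed ps
      bounded     : ∀ {z i} → OnPile z i ps → toℕ z < t
      covering    : ∀ z → toℕ z < t → ∃[ i ] OnPile z i ps
      predecessor : ∀ {z i} → OnPile z (suc i) ps → ∃[ y ] (OnPile y i ps × y ≺ z)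
      increasing  : ∀ {y z p q} → OnPile y p ps → OnPile z q ps → y ≺ z → p < q

  invariant-insert : ∀ {t ps} x → toℕ x ≡ t → Invariant t ps → Invariant (suc t) (insert A x ps)
  invariant-insert {ps = ps} x refl inv = record
    { wellFormed  = wellFormed
    ; bounded     = bounded′
    ; covering    = covering′
    ; predecessor = predecessor′
    ; increasing  = increasing′ }
    where
    open Invariant inv using (bounded; covering; predecessor; increasing)
    open Inserted (insert-spec x ps (Invariant.wellFormed inv) bounded)
    bounded′ : ∀ {z i} → OnPile z i (insert A x ps) → toℕ z < suc (toℕ x)
    bounded′ z∈ with old-or-new z∈
    ... | inj₁ z∈ps       = m<n⇒m<1+n (bounded z∈ps)
    ... | inj₂ (refl , _) = ≤-refl
    covering′ : ∀ z → toℕ z < suc (toℕ x) → ∃[ i ] OnPile z i (insert A x ps)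
    covering′ z z≤x with m<1+n⇒m<n∨m≡n z≤x
    ... | inj₁ z<x = let i , z∈ = covering z z<x in i , keeps z∈
    ... | inj₂ z≡x rewrite toℕ-injective z≡x = pile , placed
    predecessor′ : ∀ {z i} → OnPile z (suc i) (insert A x ps) → ∃[ y ] (OnPile y i (insert A x ps) × y ≺ z)
    predecessor′ z∈ with old-or-new z∈
    ... | inj₁ z∈ps = let y , y∈ , y≺z = predecessor z∈ps in y , keeps y∈ , y≺z
    ... | inj₂ (refl , 1+i≡j) =
      let y , y∈ , Ay<Ax = smaller _ (≤-reflexive 1+i≡j) in y , keeps y∈ , bounded y∈ , Ay<Ax
    increasing′ : ∀ {y z p q} → OnPile y p (insert A x ps) → OnPile z q (insert A x ps) → y ≺ z → p < q
    increasing′ y∈ z∈ y≺z@(y<z , Ay<Az) with old-or-new y∈ | old-or-new z∈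
    ... | inj₁ y∈ps       | inj₁ z∈ps       = increasing y∈ps z∈ps y≺z
    ... | inj₁ y∈ps       | inj₂ (refl , q≡j) rewrite q≡j with _ <? pile
    ...   | yes p<j = p<j
    ...   | no  p≮j = ⊥-elim (<-asym Ay<Az (larger (≮⇒≥ p≮j) y∈ps))
    increasing′ y∈ z∈ (y<z , Ay<Az) | inj₂ (refl , _) | inj₁ z∈ps = ⊥-elim (<-asym y<z (bounded z∈ps))
    increasing′ y∈ z∈ (y<z , Ay<Az) | inj₂ (refl , _) | inj₂ (refl , _) = ⊥-elim (<-irrefl refl y<z)

  data Consecutive : ℕ → ℕ → List Index → Set where
    []  : ∀ {t} → Consecutive t t []
    _∷_ : ∀ {t e x xs} → toℕ x ≡ t → Consecutive (suc t) e xs → Consecutive t e (x ∷ xs)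

  invariant-foldl : ∀ {t e xs ps} → Consecutive t e xs → Invariant t ps →
                    Invariant e (foldl (λ ps x → insert A x ps) ps xs)
  invariant-foldl []            inv = inv
  invariant-foldl (x≡t ∷ xs) inv = invariant-foldl xs (invariant-insert _ x≡t inv)

  consecutive-tabulate : ∀ k (f : Fin k → Index) t → (∀ i → toℕ (f i) ≡ t + toℕ i) →
                         Consecutive t (t + k) (tabulate f)
  consecutive-tabulate zero    f t _  rewrite +-identityʳ t = []
  consecutive-tabulate (suc k) f t fi rewrite +-suc t k =
    trans (fi fzero) (+-identityʳ t) ∷
    consecutive-tabulate k (f ∘ fsuc) (suc t) (λ i → trans (fi (fsuc i)) (+-suc t (toℕ i)))

  piles-invariant : Invariant (suc n) (piles A)
  piles-invariant = invariant-foldl (consecutive-tabulate (suc n) (λ i → i) 0 (λ _ → refl)) record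
    { wellFormed = [] ; bounded = λ () ; covering = λ _ () ; predecessor = λ () ; increasing = λ () }

  WellFormed⇒sorted : ∀ {ps} → WellFormed ps → ∀ f → AllPairs Above (lookup ps f)
  WellFormed⇒sorted (cons sorted _ _) fzero    = sorted
  WellFormed⇒sorted (cons _ _ wf)     (fsuc f) = WellFormed⇒sorted wf f

  BelowIn⇒Above : ∀ {u v p} → AllPairs Above p → BelowIn A u v p → Above v u
  BelowIn⇒Above (v>p ∷ _)     (inj₁ (refl , u∈p)) = All.lookup v>p u∈p
  BelowIn⇒Above (_ ∷ p-sorted) (inj₂ u-below-v)   = BelowIn⇒Above p-sorted u-below-v

  below-or-above : ∀ {u v p} → u ∈ₗ p → v ∈ₗ p → u ≢ v → BelowIn A u v p ⊎ BelowIn A v u p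
  below-or-above (here refl) (here refl) u≢v = ⊥-elim (u≢v refl)
  below-or-above (here refl) (there v∈p) _   = inj₂ (inj₁ (refl , v∈p))
  below-or-above (there u∈p) (here refl) _   = inj₁ (inj₁ (refl , u∈p))
  below-or-above (there u∈p) (there v∈p) u≢v = Data.Sum.map inj₂ inj₂ (below-or-above u∈p v∈p u≢v)

  onSamePile : ∀ {u v i ps} → OnPile u i ps → OnPile v i ps → u ≢ v →
               ∃[ f ] (toℕ f ≡ i × (BelowIn A u v (lookup ps f) ⊎ BelowIn A v u (lookup ps f)))
  onSamePile (here u∈p)   (here v∈p)   u≢v = fzero , refl , below-or-above u∈p v∈p u≢v
  onSamePile (there u∈ps) (there v∈ps) u≢v =
    let f , f≡i , below = onSamePile u∈ps v∈ps u≢v in fsuc f , cong suc f≡i , below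

-- Piles of maximum increasing subsequences

module Ranks {n : ℕ} (A : Fin (suc n) → ℕ) (A-injective : Injective _≡_ _≡_ A) where

  open Increasing A
  open PatienceSorting A A-injective
  open Invariant piles-invariant

  pileOf : ∀ x → ∃[ i ] OnPile x i (piles A)
  pileOf x = covering x (toℕ<n x)

  rank : Subset (suc n) → Index → ℕ
  rank S x = count (χ S) (toℕ x)

  chain-to : ∀ {x p} → OnPile x p (piles A) →
          ∃[ C ] (Feasible A C × x ∈ C × (∀ {y} → y ∈ C → toℕ y ≤ toℕ x) × suc p ≤ count (χ C) (suc (toℕ x)))
  chain-to {x} {zero} _ =
    ⁅ x ⁆ , Feasible-⁅⁆ x , x∈⁅x⁆ x , (λ y∈ → ≤-reflexive (cong toℕ (x∈⁅y⁆⇒x≡y x y∈))) ,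
    subst (1 ≤_) (sym (count-true (χ ⁅ x ⁆) (∈⇒χ (x∈⁅x⁆ x)))) (s≤s z≤n)
  chain-to {x} {suc p} x∈ with predecessor x∈
  ... | y , y∈ , y≺x@(y<x , _) with chain-to y∈
  ...   | C , fC , y∈C , C≤y , p<C = C ∪ ⁅ x ⁆ , Feasible-∪⁅⁆ fC C≺x , x∈C′ , C′≤x , p+1<C′
    where
    C≺x : ∀ {w} → w ∈ C → w ≺ x
    C≺x {w} w∈C with m≤n⇒m<n∨m≡n (C≤y w∈C)
    ... | inj₁ w<y = <-trans w<y y<x , <-trans (fC w y w∈C y∈C w<y) (proj₂ y≺x)
    ... | inj₂ w≡y rewrite toℕ-injective w≡y = y≺x
    x∈C′ : x ∈ C ∪ ⁅ x ⁆
    x∈C′ = x∈p∪q⁺ (inj₂ (x∈⁅x⁆ x))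
    C′≤x : ∀ {w} → w ∈ C ∪ ⁅ x ⁆ → toℕ w ≤ toℕ x
    C′≤x w∈ with x∈p∪q⁻ C _ w∈
    ... | inj₁ w∈C = <⇒≤ (proj₁ (C≺x w∈C))
    ... | inj₂ w∈x = ≤-reflexive (cong toℕ (x∈⁅y⁆⇒x≡y x w∈x))
    p+1<C′ : suc (suc p) ≤ count (χ (C ∪ ⁅ x ⁆)) (suc (toℕ x))
    p+1<C′ rewrite count-true (χ (C ∪ ⁅ x ⁆)) (∈⇒χ x∈C′) = s≤s (begin
      suc p                          ≤⟨ p<C ⟩
      count (χ C) (suc (toℕ y))      ≤⟨ count-monoʳ (χ C) y<x ⟩
      count (χ C) (toℕ x)            ≤⟨ count-⊆ {S = C} (toℕ x) (p⊆p∪q ⁅ x ⁆) ⟩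
      count (χ (C ∪ ⁅ x ⁆)) (toℕ x)  ∎)
      where open ≤-Reasoning

  count-below-pile : ∀ {S} → Feasible A S → ∀ t {z p} → z ∈ S → t ≤ toℕ z → OnPile z p (piles A) →
                     count (χ S) t ≤ p
  count-below-pile fS zero    _ _ _ = z≤n
  count-below-pile {S} fS (suc t) z∈S t<z z∈p with χ S t in e
  ... | false = count-below-pile fS t z∈S (<⇒≤ t<z) z∈p
  ... | true with χ⇒∃∈ {S = S} e
  ...   | w , w∈S , refl = let q , w∈q = pileOf w in
          ≤-<-trans (count-below-pile fS (toℕ w) w∈S ≤-refl w∈q)
                    (increasing w∈q z∈p (t<z , fS w _ w∈S z∈S t<z))

  rank≤pile : ∀ {S z p} → Feasible A S → z ∈ S → OnPile z p (piles A) → rank S z ≤ p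
  rank≤pile fS z∈S = count-below-pile fS _ z∈S ≤-refl

  pile≤rank : ∀ {I x p} → Max A I → x ∈ I → OnPile x p (piles A) → p ≤ rank I x
  pile≤rank {I} {x} {p} (fI , I-max) x∈I x∈p with p ≤? rank I x | chain-to x∈p
  ... | yes p≤r | _ = p≤r
  ... | no  p≰r | C , fC , x∈C , C≤x , p<C = ⊥-elim (<⇒≱ ∣I∣<∣J∣ (I-max J fJ))
    where
    -- the chain ending at x followed by the part of I after x would be longer than I
    s = suc (toℕ x)
    J = splice C I s
    fJ : Feasible A J
    fJ = Feasible-splice s fC fI λ {y} {z} y∈C z∈I _ x<z → ≤-<-trans (A≤Ax y∈C) (fI x z x∈I z∈I x<z)
      where
      A≤Ax : ∀ {y} → y ∈ C → A y ≤ A x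
      A≤Ax {y} y∈C with m≤n⇒m<n∨m≡n (C≤x y∈C)
      ... | inj₁ y<x = <⇒≤ (fC y x y∈C x∈C y<x)
      ... | inj₂ y≡x rewrite toℕ-injective y≡x = ≤-refl
    r = rank I x
    ∣I∣<∣J∣ : ∣ I ∣ < ∣ J ∣
    ∣I∣<∣J∣ = subst₂ _<_ (sym (∣∣≡count I)) (sym (∣∣≡count J)) (+-cancelʳ-< (suc r) _ _ (begin-strict
      count (χ I) (suc n) + suc r  <⟨ +-monoʳ-< (count (χ I) (suc n)) (s≤s (≰⇒> p≰r)) ⟩
      count (χ I) (suc n) + suc p  ≤⟨ +-monoʳ-≤ (count (χ I) (suc n)) p<C ⟩
      count (χ I) (suc n) + count (χ C) s
        ≡⟨ cong (count (χ I) (suc n) +_) (count-cong s (λ _ t<s → χ-splice-< C I t<s)) ⟨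
      count (χ I) (suc n) + count (χ J) s
        ≡⟨ count-agree-from s (suc n) (toℕ<n x) (λ _ s≤t → χ-splice-≥ C I s≤t) ⟨
      count (χ J) (suc n) + count (χ I) s
        ≡⟨ cong (count (χ J) (suc n) +_) (count-true (χ I) (∈⇒χ x∈I)) ⟩
      count (χ J) (suc n) + suc r  ∎))
      where open ≤-Reasoning

  pile≡rank : ∀ {I x p} → Max A I → x ∈ I → OnPile x p (piles A) → p ≡ rank I x
  pile≡rank I-max x∈I x∈p = ≤-antisym (pile≤rank I-max x∈I x∈p) (rank≤pile (proj₁ I-max) x∈I x∈p)

  pile<∣∣ : ∀ {S x q} → Max A S → x ∈ S → OnPile x q (piles A) → q < ∣ S ∣
  pile<∣∣ {S} {x} {q} S-max x∈S x∈q = begin-strict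
    q                    ≡⟨ pile≡rank S-max x∈S x∈q ⟩
    count (χ S) (toℕ x)  <⟨ count-strict (χ S) (∈⇒χ x∈S) (toℕ<n x) ⟩
    count (χ S) (suc n)  ≡⟨ ∣∣≡count S ⟨
    ∣ S ∣                ∎
    where open ≤-Reasoning

  inhabited-pile : ∀ {S q} → Max A S → q < ∣ S ∣ → ∃[ w ] (w ∈ S × OnPile w q (piles A))
  inhabited-pile {S} {q} S-max q<∣S∣ with count-hits (χ S) (suc n) (subst (q <_) (∣∣≡count S) q<∣S∣)
  ... | t , _ , χt , rank≡q with χ⇒∃∈ {S = S} χt
  ...   | w , w∈S , refl = let p , w∈p = pileOf w in
          w , w∈S , subst (λ p → OnPile w p (piles A)) (trans (pile≡rank S-max w∈S w∈p) rank≡q) w∈p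

-- Reconfiguration steps between maximum increasing subsequences

module Decidability {n : ℕ} (A : Fin (suc n) → ℕ) where

  open import Data.List.Membership.DecPropositional (_≟_ {suc n}) using () renaming (_∈?_ to _∈ₗ?_)

  below? : ∀ u v p → Dec (BelowIn A u v p)
  below? u v []      = no λ ()
  below? u v (x ∷ p) = ((x ≟ v) ×-dec (u ∈ₗ? p)) ⊎-dec below? u v p

  placedBelow? : ∀ u v → Dec (PlacedBelow A u v)
  placedBelow? u v = anyFin? λ i → (1 ≤? toℕ i) ×-dec below? u v (lookup (piles A) i)

  feasible? : ∀ X → Dec (Feasible A X)
  feasible? X = allFin? λ i → allFin? λ j →
    (i ∈? X) →-dec (j ∈? X) →-dec (toℕ i <? toℕ j) →-dec (A i <? A j)

ext-injective : ∀ {n} {a : Fin n → ℕ} → Injective _≡_ _≡_ a → (∀ i → 1 ≤ a i) → Injective _≡_ _≡_ (ext a)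
ext-injective a-injective a-positive {fzero}  {fzero}  _ = refl
ext-injective a-injective a-positive {fzero}  {fsuc j} e = ⊥-elim (<⇒≢ (a-positive j) e)
ext-injective a-injective a-positive {fsuc i} {fzero}  e = ⊥-elim (<⇒≢ (a-positive i) (sym e))
ext-injective a-injective a-positive {fsuc i} {fsuc j} e = cong fsuc (a-injective e)

module Reconfiguration {n : ℕ} (a : Fin n → ℕ) (a-injective : Injective _≡_ _≡_ a)
                       (a-positive : ∀ i → 1 ≤ a i) where

  A : Fin (suc n) → ℕ
  A = ext a

  open PatienceSorting A (ext-injective a-injective a-positive)
  open Invariant piles-invariant
  open Ranks A (ext-injective a-injective a-positive)
  open Decidability A

  onPile0⇒≡0 : ∀ {x} → OnPile x 0 (piles A) → x ≡ fzero
  onPile0⇒≡0 {fzero}  _   = refl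
  onPile0⇒≡0 {fsuc i} x∈0 =
    let p , 0∈p = pileOf fzero in ⊥-elim (n≮0 (increasing 0∈p x∈0 (s≤s z≤n , a-positive i)))

  onSamePile⇒≡ : ∀ {S y z p} → Feasible A S → y ∈ S → z ∈ S →
                 OnPile y p (piles A) → OnPile z p (piles A) → y ≡ z
  onSamePile⇒≡ fS y∈S z∈S y∈p z∈p with <-cmp (toℕ _) (toℕ _)
  ... | tri< y<z _ _ = ⊥-elim (<-irrefl refl (increasing y∈p z∈p (y<z , fS _ _ y∈S z∈S y<z)))
  ... | tri≈ _ y≡z _ = toℕ-injective y≡z
  ... | tri> _ _ z<y = ⊥-elim (<-irrefl refl (increasing z∈p y∈p (z<y , fS _ _ z∈S y∈S z<y)))

  exchange-Max : ∀ {X j k} → Max A X → Feasible A (exchange X j k) → j ∉ X → k ∈ X → Max A (exchange X j k)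
  exchange-Max (_ , X-max) fY j∉X k∈X = fY , λ J fJ → subst (∣ J ∣ ≤_) (sym (∣exchange∣ j∉X k∈X)) (X-max J fJ)

  exchange-onSamePile : ∀ {X j k q} → Max A X → Max A (exchange X j k) → j ∉ X → k ∈ X →
                        OnPile j q (piles A) → OnPile k q (piles A)
  -- some w ∈ X shares j's pile, and w ≢ k would put two elements of exchange X j k on it
  exchange-onSamePile {X} {j} {k} X-max Y-max j∉X k∈X j∈q
    with inhabited-pile X-max (subst (_ <_) (∣exchange∣ j∉X k∈X) (pile<∣∣ Y-max (j∈exchange j∉X k∈X) j∈q))
  ... | w , w∈X , w∈q with w ≟ k
  ...   | yes refl = w∈q
  ...   | no  w≢k  = ⊥-elim (j∉X (subst (_∈ X) w≡j w∈X))
    where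
    w≡j = onSamePile⇒≡ (proj₁ Y-max) (∈-exchange⁺ (inj₁ w∈X) w≢k) (j∈exchange j∉X k∈X) w∈q j∈q

  two-onPile⇒1≤ : ∀ {u v q} → OnPile u q (piles A) → OnPile v q (piles A) → u ≢ v → 1 ≤ q
  two-onPile⇒1≤ {q = zero}  u∈0 v∈0 u≢v = ⊥-elim (u≢v (trans (onPile0⇒≡0 u∈0) (sym (onPile0⇒≡0 v∈0))))
  two-onPile⇒1≤ {q = suc _} _   _   _   = s≤s z≤n

  exchange-placedBelow : ∀ {X j k} → Max A X → Max A (exchange X j k) → j ∉ X → k ∈ X →
                         PlacedBelow A k j ⊎ PlacedBelow A j k
  exchange-placedBelow {X} {j} {k} X-max Y-max j∉X k∈X =
    let q , j∈q       = pileOf j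
        k∈q           = exchange-onSamePile X-max Y-max j∉X k∈X j∈q
        f , f≡q , k∼j = onSamePile k∈q j∈q k≢j
        1≤f           = subst (1 ≤_) (sym f≡q) (two-onPile⇒1≤ k∈q j∈q k≢j)
    in Data.Sum.map (λ below → f , 1≤f , below) (λ below → f , 1≤f , below) k∼j
    where
    k≢j : k ≢ j
    k≢j refl = j∉X k∈X

  placedBelow⇒Above : ∀ {u v} → PlacedBelow A u v → Above v u
  placedBelow⇒Above (f , _ , below) = BelowIn⇒Above (WellFormed⇒sorted wellFormed f) below

  exchange-◁ : ∀ {X u v} → Max A X → Feasible A (exchange X u v) → u ∉ X → v ∈ X → PlacedBelow A u v →
               _◁_ A (exchange X u v) X
  exchange-◁ X-max fY u∉X v∈X u-below-v =
    let X─Y , Y─X = exchange-─ u∉X v∈X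
    in exchange-Max X-max fY u∉X v∈X , X-max , _ , _ , Y─X , X─Y , u-below-v

  _⟶_ : Subset (suc n) → Subset (suc n) → Set
  X ⟶ Y = _◁_ A Y X

  _—↠_ : Subset (suc n) → Subset (suc n) → Set
  _—↠_ = Star _⟶_

  RStep⇒⟶ : ∀ {X Y} → Max A X → RStep A X Y → Max A Y × SymClosure _⟶_ X Y
  RStep⇒⟶ X-max (_ , fY , j , k , j∉X , k∈X , refl) with exchange-Max X-max fY j∉X k∈X
  ... | Y-max with exchange-placedBelow X-max Y-max j∉X k∈X | exchange-─ j∉X k∈X
  ...   | inj₁ k-below-j | X─Y , Y─X = Y-max , bwd (X-max , Y-max , k , j , X─Y , Y─X , k-below-j)
  ...   | inj₂ j-below-k | X─Y , Y─X = Y-max , fwd (Y-max , X-max , j , k , Y─X , X─Y , j-below-k)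

  ⟶⇒RStep : ∀ {X Y} → X ⟶ Y → RStep A Y X × RStep A X Y
  ⟶⇒RStep (Y-max , X-max , u , v , Y─X , X─Y , _)
    with ─≡⁅⁆⇒exchange Y─X X─Y | ─≡⁅⁆⇒exchange X─Y Y─X
  ... | v∉Y , u∈Y , X≡ | u∉X , v∈X , Y≡ =
    (proj₁ Y-max , proj₁ X-max , v , u , v∉Y , u∈Y , X≡) ,
    (proj₁ X-max , proj₁ Y-max , u , v , u∉X , v∈X , Y≡)

  ⟶-view : ∀ {J J′} → J ⟶ J′ → ∃[ u ] ∃[ v ] (u ∉ J × v ∈ J × J′ ≡ exchange J u v × PlacedBelow A u v)
  ⟶-view (_ , _ , u , v , J′─J , J─J′ , u-below-v) =
    let u∉J , v∈J , J′≡ = ─≡⁅⁆⇒exchange J─J′ J′─J in u , v , u∉J , v∈J , J′≡ , u-below-v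

  μ : Subset (suc n) → ℕ
  μ = weight toℕ

  ⟶⇒μ> : ∀ {X Y} → X ⟶ Y → μ Y < μ X
  ⟶⇒μ> X⟶Y with ⟶-view X⟶Y
  ... | u , v , u∉X , v∈X , refl , u-below-v = ≰⇒> λ μX≤μY →
    <-irrefl (sym (weight-exchange toℕ u∉X v∈X)) (+-mono-<-≤ (proj₁ (placedBelow⇒Above u-below-v)) μX≤μY)

  join-sameRemoved : ∀ {J u₁ u₂ v} → u₁ ∉ J → u₂ ∉ J → v ∈ J →
                     Max A (exchange J u₁ v) → Max A (exchange J u₂ v) →
                     ∃[ K ] (exchange J u₁ v —↠ K × exchange J u₂ v —↠ K)
  join-sameRemoved {J} {u₁} {u₂} {v} u₁∉J u₂∉J v∈J J₁-max J₂-max with u₁ ≟ u₂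
  ... | yes refl = _ , ε , ε
  ... | no u₁≢u₂ with RStep⇒⟶ J₁-max (proj₁ J₁-max , proj₁ J₂-max , u₂ , u₁ , u₂∉J₁ , u₁∈J₁ , J₂≡)
    where
    u₁∈J₁ = j∈exchange u₁∉J v∈J
    u₂∉J₁ = ∉exchange u₂∉J (u₁≢u₂ ∘ sym)
    J₂≡ = sym (exchange-cancel u₁∉J u₁≢u₂ λ { refl → u₂∉J v∈J })
  ... | _ , fwd J₁⟶J₂ = _ , J₁⟶J₂ ◅ ε , ε
  ... | _ , bwd J₂⟶J₁ = _ , ε , J₂⟶J₁ ◅ ε

  join-distinctRemoved : ∀ {J u₁ v₁ u₂ v₂} → u₁ ∉ J → v₁ ∈ J → u₂ ∉ J → v₂ ∈ J → v₁ ≢ v₂ →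
                         Max A (exchange J u₁ v₁) → Max A (exchange J u₂ v₂) →
                         PlacedBelow A u₁ v₁ → PlacedBelow A u₂ v₂ →
                         ∃[ K ] (exchange J u₁ v₁ ⟶ K × exchange J u₂ v₂ ⟶ K)
  join-distinctRemoved {J} {u₁} {v₁} {u₂} {v₂} u₁∉J v₁∈J u₂∉J v₂∈J v₁≢v₂ J₁-max J₂-max
                       u₁-below-v₁ u₂-below-v₂ =
    K ,
    subst (J₁ ⟶_) (sym K≡) (exchange-◁ J₁-max (subst (Feasible A) K≡ fK) u₂∉J₁ v₂∈J₁ u₂-below-v₂) ,
    exchange-◁ J₂-max fK u₁∉J₂ v₁∈J₂ u₁-below-v₁
    where
    J₁ = exchange J u₁ v₁
    J₂ = exchange J u₂ v₂
    K  = exchange J₂ u₁ v₁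
    fJ₁ = proj₁ J₁-max
    fJ₂ = proj₁ J₂-max
    u₁∈J₁ = j∈exchange u₁∉J v₁∈J
    u₂∈J₂ = j∈exchange u₂∉J v₂∈J
    v₂∈J₁ = ∈-exchange⁺ (inj₁ v₂∈J) (v₁≢v₂ ∘ sym)
    v₁∈J₂ = ∈-exchange⁺ (inj₁ v₁∈J) v₁≢v₂
    v₁>u₁ = placedBelow⇒Above u₁-below-v₁
    v₂>u₂ = placedBelow⇒Above u₂-below-v₂
    u₁≢u₂ : u₁ ≢ u₂
    u₁≢u₂ refl = <-asym (fJ₁ u₁ v₂ u₁∈J₁ v₂∈J₁ (proj₁ v₂>u₂)) (proj₂ v₂>u₂)
    u₁∉J₂ = ∉exchange u₁∉J u₁≢u₂
    u₂∉J₁ = ∉exchange u₂∉J (u₁≢u₂ ∘ sym)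
    K≡ : K ≡ exchange J₁ u₂ v₂
    K≡ = exchange-comm (λ { refl → u₂∉J v₁∈J }) (λ { refl → u₁∉J v₂∈J })
    below-cover : ∀ {X x y w} → Feasible A X → x ∈ X → w ∈ X → Above w y → toℕ x < toℕ y → A x < A y
    below-cover fX x∈X w∈X (y<w , Aw<Ay) x<y = <-trans (fX _ _ x∈X w∈X (<-trans x<y y<w)) Aw<Ay
    in₁ : ∀ {y} → y ∈ K → y ∈ J₁ ⊎ y ≡ u₂
    in₁ y∈K = proj₁ (∈-exchange⁻ (subst (_ ∈_) K≡ y∈K))
    in₂ : ∀ {y} → y ∈ K → y ∈ J₂ ⊎ y ≡ u₁
    in₂ y∈K = proj₁ (∈-exchange⁻ y∈K)
    fK : Feasible A K
    fK y z y∈K z∈K y<z with in₁ y∈K | in₁ z∈K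
    ... | inj₁ y∈J₁ | inj₁ z∈J₁ = fJ₁ y z y∈J₁ z∈J₁ y<z
    ... | inj₂ refl | inj₂ refl = ⊥-elim (<-irrefl refl y<z)
    ... | inj₁ _    | inj₂ refl with in₂ y∈K
    ...   | inj₁ y∈J₂ = fJ₂ y u₂ y∈J₂ u₂∈J₂ y<z
    ...   | inj₂ refl = below-cover fJ₁ u₁∈J₁ v₂∈J₁ v₂>u₂ y<z
    fK y z y∈K z∈K y<z | inj₂ refl | inj₁ _ with in₂ z∈K
    ...   | inj₁ z∈J₂ = fJ₂ u₂ z u₂∈J₂ z∈J₂ y<z
    ...   | inj₂ refl = below-cover fJ₂ u₂∈J₂ v₁∈J₂ v₁>u₁ y<z

  weaklyConfluent : WeaklyConfluent _⟶_
  weaklyConfluent J⟶J₁ J⟶J₂ with ⟶-view J⟶J₁ | ⟶-view J⟶J₂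
  ... | u₁ , v₁ , u₁∉J , v₁∈J , refl , u₁-below-v₁ | u₂ , v₂ , u₂∉J , v₂∈J , refl , u₂-below-v₂
    with v₁ ≟ v₂
  ...   | yes refl = join-sameRemoved u₁∉J u₂∉J v₁∈J (proj₁ J⟶J₁) (proj₁ J⟶J₂)
  ...   | no v₁≢v₂ =
    let K , J₁⟶K , J₂⟶K = join-distinctRemoved u₁∉J v₁∈J u₂∉J v₂∈J v₁≢v₂ (proj₁ J⟶J₁) (proj₁ J⟶J₂)
                                                u₁-below-v₁ u₂-below-v₂
    in K , J₁⟶K ◅ ε , J₂⟶K ◅ ε

  ⟶⁺⇒μ> : ∀ {X Y} → Plus _⟶_ X Y → μ Y < μ X
  ⟶⁺⇒μ> [ X⟶Y ]            = ⟶⇒μ> X⟶Y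
  ⟶⁺⇒μ> (_ ∼⁺⟨ X⁺Y ⟩ Y⁺Z) = <-trans (⟶⁺⇒μ> Y⁺Z) (⟶⁺⇒μ> X⁺Y)

  confluent : Confluent _⟶_
  confluent = sn&wcr⇒cr (Subrelation.wellFounded ⟶⁺⇒μ> (On.wellFounded μ <-wellFounded)) weaklyConfluent

  reducible? : ∀ {J} → Max A J → Dec (∃[ J′ ] (J ⟶ J′))
  reducible? {J} J-max
    with anyFin? (λ u → anyFin? λ v →
           ¬? (u ∈? J) ×-dec (v ∈? J) ×-dec feasible? (exchange J u v) ×-dec placedBelow? u v)
  ... | yes (u , v , u∉J , v∈J , fJ′ , u-below-v) = yes (_ , exchange-◁ J-max fJ′ u∉J v∈J u-below-v)
  ... | no none = no λ (J′ , J⟶J′) →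
    let u , v , u∉J , v∈J , J′≡ , u-below-v = ⟶-view J⟶J′
    in none (u , v , u∉J , v∈J , subst (Feasible A) J′≡ (proj₁ (proj₁ J⟶J′)) , u-below-v)

  normalForm : ∀ {J} → Max A J → HasNormalForm _⟶_ J
  normalForm J-max = go (<-wellFounded _) J-max
    where
    go : ∀ {J} → Acc _<_ (μ J) → Max A J → HasNormalForm _⟶_ J
    go (acc smaller) J-max with reducible? J-max
    ... | no  irreducible   = _ , irreducible , ε
    ... | yes (_ , J⟶J′) =
      let K , K-normal , J′↠K = go (smaller (⟶⇒μ> J⟶J′)) (proj₁ J⟶J′) in K , K-normal , J⟶J′ ◅ J′↠K

  —↠-Max : ∀ {X Y} → Max A X → X —↠ Y → Max A Y
  —↠-Max X-max ε          = X-max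
  —↠-Max _     (X⟶Y ◅ Y↠Z) = —↠-Max (proj₁ X⟶Y) Y↠Z

  InM⇒—↠ : ∀ {I K} → InM A I K → I —↠ K
  InM⇒—↠ base            = ε
  InM⇒—↠ (down I↠J K◁J) = InM⇒—↠ I↠J ◅◅ (K◁J ◅ ε)

  —↠⇒InM : ∀ {I K} → I —↠ K → InM A I K
  —↠⇒InM = extend base
    where
    extend : ∀ {I J K} → InM A I J → J —↠ K → InM A I K
    extend I↠J ε           = I↠J
    extend I↠J (J⟶J′ ◅ J′↠K) = extend (down I↠J J⟶J′) J′↠K

  Reconf⇒↔ : ∀ {X Y} → Max A X → Star (RStep A) X Y → EqClosure _⟶_ X Y
  Reconf⇒↔ _     ε          = ε
  Reconf⇒↔ X-max (step ◅ steps) = let Y-max , X∼Y = RStep⇒⟶ X-max step in X∼Y ◅ Reconf⇒↔ Y-max steps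

  Reconf⇒◁-Equiv : ∀ {I J} → Max A I → Reconf A I J → ◁-Equiv A I J
  Reconf⇒◁-Equiv I-max (_ , steps) =
    let K , K-normal , I↠K = normalForm I-max
        J↔K = symmetric _⟶_ (Reconf⇒↔ I-max steps) ◅◅ a—↠b⇒a↔b I↠K
    in K , (—↠-Max I-max I↠K , K-normal) , —↠⇒InM I↠K , —↠⇒InM (conf⇒nf confluent K-normal J↔K)

  ◁-Equiv⇒Reconf : ∀ {I J} → Max A I → ◁-Equiv A I J → Reconf A I J
  ◁-Equiv⇒Reconf I-max (_ , _ , I↠K , J↠K) =
    proj₁ I-max , Star.map (proj₂ ∘ ⟶⇒RStep) (InM⇒—↠ I↠K) ◅◅ Star.reverse (proj₁ ∘ ⟶⇒RStep) (InM⇒—↠ J↠K)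

lemma3 : (n : ℕ) (a : Fin n → ℕ) → Injective _≡_ _≡_ a → (∀ i → 1 ≤ a i × a i ≤ n) →
         (I J : Subset (suc n)) → Max (ext a) I → Max (ext a) J →
         (Reconf (ext a) I J → ◁-Equiv (ext a) I J) × (◁-Equiv (ext a) I J → Reconf (ext a) I J)
lemma3 n a a-injective bounds I J I-max _ = Reconf⇒◁-Equiv I-max , ◁-Equiv⇒Reconf I-max
  where open Reconfiguration a a-injective (proj₁ ∘ bounds)
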